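{- For any integer $\ell\ge 2$ there exists a graph $G$ such that $G\notin\mathrm{MTD}_\ell$, but $G\in\mathrm{MW}_{2\ell}$.
   Context: Graphs are finite and simple. Operations: $\circ,\bullet$ return the empty and the one-vertex graph; $\mathrm{Union}_t$ ($t\ge2$) is disjoint union; $\mathrm{Join}_t$ is disjoint union plus all edges between different arguments; $\mathrm{Inc}_{x,E_x}(G)=(V\cup\{x\},E\cup E_x)$ for $G=(V,E)$, $x\notin V$, $E_x\subseteq\{\{x,v\}\mid v\in V\}$; $\mathrm{Subst}_H(G_1,\dots,G_t)$ for $V(H)=\{v_1,\dots,v_t\}$ replaces each $v_i$ by a disjoint copy of $G_i$ and adds all edges between $V(G_i)$ and $V(G_j)$ whenever $\{v_i,v_j\}\in E(H)$. A graph has an algebraic expression over a set of operations if it is (up to renaming) the value of it; the empty graph corresponds to the empty expression. The nesting depth of an operation is the maximum number of expression-tree nodes labelled by it on a root-to-leaf path. $\mathrm{td}(G)$ is the least $k$ such that $G$ has an expression over $\{\circ,\mathrm{Union}\}\cup\{\mathrm{Inc}_{x,E_x}\}$ with $\mathrm{Inc}$ nesting depth at most $k$. $\mathrm{MW}_h$: graphs with an expression over $\{\bullet,\mathrm{Union},\mathrm{Join}\}\cup\{\mathrm{Subst}_H\mid|V(H)|\le h\}$. $\mathrm{MTD}_\ell$: graphs with an expression over $\{\bullet,\mathrm{Union},\mathrm{Join}\}\cup\{\mathrm{Subst}_H\mid\mathrm{td}(H)\le\ell\}$. -}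

module Defs where

open import Data.Nat using (ℕ; zero; suc; _≤_; _*_)
open import Data.Fin using (Fin; _≟_)
open import Data.Bool using (Bool; true; false; not)
open import Data.Unit using (⊤; tt)
open import Data.Empty using (⊥)
open import Data.Sum using (_⊎_; inj₁; inj₂)
open import Data.Product using (Σ; Σ-syntax; _×_; _,_)
open import Relation.Nullary using (¬_; yes; no)
open import Relation.Binary.PropositionalEquality using (_≡_; refl)
open import Function.Bundles using (_↔_; Inverse)
open import Level using (Lift)
import Level

-- Finiteness and simplicity are separate predicates (all graphs built
-- by the operations below are automatically finite and simple).
record Graph : Set₁ where
  constructor mkGraph
  field
    V : Set
    E : V → V → Bool
open Graph public

Simple : Graph → Set
Simple G = (∀ u v → E G u v ≡ E G v u) × (∀ v → E G v v ≡ false)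

Finite : Graph → Set
Finite G = Σ ℕ λ n → V G ↔ Fin n

_≅_ : Graph → Graph → Set
G ≅ H = Σ (V G ↔ V H) λ f →
          ∀ u v → E G u v ≡ E H (Inverse.to f u) (Inverse.to f v)

SimpleAdj : (m : ℕ) → (Fin m → Fin m → Bool) → Set
SimpleAdj m A = (∀ i j → A i j ≡ A j i) × (∀ i → A i i ≡ false)

FinGraph : (m : ℕ) → (Fin m → Fin m → Bool) → Graph
FinGraph m A = mkGraph (Fin m) A

emptyGraph : Graph
emptyGraph = mkGraph ⊥ (λ ())

oneGraph : Graph
oneGraph = mkGraph ⊤ (λ _ _ → false)

private
  substAdj : (m : ℕ) (A : Fin m → Fin m → Bool) (Gs : Fin m → Graph) →
           (i : Fin m) → V (Gs i) → (j : Fin m) → V (Gs j) → Bool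
  substAdj m A Gs i u j v with i ≟ j
  ... | yes refl = E (Gs i) u v
  ... | no _ = A i j

Subst : (m : ℕ) → (Fin m → Fin m → Bool) → (Fin m → Graph) → Graph
Subst m A Gs = mkGraph (Σ (Fin m) (λ i → V (Gs i)))
  (λ { (i , u) (j , v) → substAdj m A Gs i u j v })

Union : (t : ℕ) → (Fin t → Graph) → Graph
Union t = Subst t (λ _ _ → false)

private
  neq : {t : ℕ} → Fin t → Fin t → Bool
  neq i j with i ≟ j
  ... | yes _ = false
  ... | no _ = true

Join : (t : ℕ) → (Fin t → Graph) → Graph
Join t = Subst t neq

Inc : (G : Graph) → (V G → Bool) → Graph
Inc G N = mkGraph (V G ⊎ ⊤) e
  where
  e : V G ⊎ ⊤ → V G ⊎ ⊤ → Bool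
  e (inj₁ u) (inj₁ v) = E G u v
  e (inj₁ u) (inj₂ _) = N u
  e (inj₂ _) (inj₁ v) = N v
  e (inj₂ _) (inj₂ _) = false

-- Expressions over {∘, Union} ∪ {Inc_{x,E_x}} with Inc nesting depth ≤ k
-- (the empty expression denotes the empty graph, as does ∘).
data TDExpr : ℕ → Graph → Set₁ where
  ∘e     : ∀ {k} → TDExpr k emptyGraph
  unionE : ∀ {k} (t : ℕ) → 2 ≤ t → (Gs : Fin t → Graph) →
           (∀ i → TDExpr k (Gs i)) → TDExpr k (Union t Gs)
  incE   : ∀ {k} (G : Graph) (N : V G → Bool) →
           TDExpr k G → TDExpr (suc k) (Inc G N)

tdLE : Graph → ℕ → Set₁
tdLE G k = Σ Graph λ G' → TDExpr k G' × (G ≅ G')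

data SubstExpr (P : (m : ℕ) → (Fin m → Fin m → Bool) → Set₁) : Graph → Set₁ where
  •e     : SubstExpr P oneGraph
  unionE : (t : ℕ) → 2 ≤ t → (Gs : Fin t → Graph) →
           (∀ i → SubstExpr P (Gs i)) → SubstExpr P (Union t Gs)
  joinE  : (t : ℕ) → 2 ≤ t → (Gs : Fin t → Graph) →
           (∀ i → SubstExpr P (Gs i)) → SubstExpr P (Join t Gs)
  substE : (m : ℕ) (A : Fin m → Fin m → Bool) → SimpleAdj m A → P m A →
           (Gs : Fin m → Graph) →
           (∀ i → SubstExpr P (Gs i)) → SubstExpr P (Subst m A Gs)

HasSubstExpr : ((m : ℕ) → (Fin m → Fin m → Bool) → Set₁) → Graph → Set₁
HasSubstExpr P G = Σ Graph λ G' → SubstExpr P G' × (G ≅ G')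

MW : ℕ → Graph → Set₁
MW h = HasSubstExpr (λ m A → Lift (Level.suc Level.zero) (m ≤ h))

MTD : ℕ → Graph → Set₁
MTD ℓ = HasSubstExpr (λ m A → tdLE (FinGraph m A) ℓ)

{-# OPTIONS --safe #-}
module Submission where

-- Take for X the complement of the path 0 - 1 - ⋯ - (2ℓ-1), where a and b are adjacent iff
-- |a - b| ≥ 2.  Trivially X = Subst_X(•, …, •) ∈ MW_{2ℓ}.  Conversely, X is prime: a set of at
-- least two of its vertices that every outside vertex sees uniformly is everything.  So in an
-- expression of X all vertices stay inside one argument until some operation puts them into
-- pairwise distinct arguments; that operation is not a Union or a Join (X and its complement are
-- connected), hence a Subst_H with X an induced subgraph of H.  Finally, an induced subgraph of
-- the complement of the infinite path on r ≥ 4 vertices is connected, and any three of its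
-- vertices span an edge; peeling off Inc vertices shows that its td is at least r - 1, so
-- td(H) ≥ 2ℓ - 1 > ℓ.

open import Defs
open import Data.Nat using (ℕ; zero; suc; _+_; _*_; _≤_; _<_; z≤n; s≤s; _<?_;
  _≤′_; ≤′-refl; ≤′-step; _≤‴_; ≤‴-refl; ≤‴-step)
import Data.Nat as ℕ
open import Data.Nat.Properties using (≤-refl; ≤-trans; ≤-total; <⇒≤; <⇒≢; <⇒≱; <-cmp;
  n≤1+n; m≤n⇒m≤1+n; m≤n⇒m<n∨m≡n; 1+n≰n; suc-injective; +-suc; +-comm; +-identityʳ;
  +-mono-<; +-monoʳ-<; *-monoʳ-≤; ≤⇒≤′; ≤′⇒≤; ≤⇒≤‴; ≤‴⇒≤; module ≤-Reasoning)
open import Data.Fin using (Fin; zero; suc; toℕ; fromℕ<; punchIn; #_; _≟_)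
open import Data.Fin.Properties using (toℕ-injective; toℕ-fromℕ<; toℕ<n; any?; all?;
  ¬∀⟶∃¬; punchIn-injective; punchInᵢ≢i)
open import Data.Bool using (Bool; true; false; not)
open import Data.Unit using (⊤; tt)
open import Data.Sum using (_⊎_; inj₁; inj₂; [_,_])
open import Data.Product using (Σ; _×_; _,_; proj₁; proj₂; ∃; ∃₂)
open import Data.Empty using (⊥; ⊥-elim)
open import Function using (_∘_)
open import Function.Definitions using (Injective)
open import Function.Bundles using (Inverse; Injection; mk↔ₛ′)
open import Function.Properties.Inverse using (↔⇒↣)
open import Function.Construct.Identity using (↔-id)
open import Level using (0ℓ; lift)
open import Relation.Nullary using (¬_; Dec; yes; no; does; ¬?; contradiction)
open import Relation.Nullary.Decidable using (_×-dec_; _⊎-dec_; dec-true; dec-false;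
  decidable-stable)
open import Relation.Unary using (Pred; Decidable)
open import Relation.Binary.PropositionalEquality using (_≡_; _≢_; refl; sym; trans; cong; cong₂;
  module ≡-Reasoning)
open import Relation.Binary.Definitions using (tri<; tri≈; tri>)

module _ {m : ℕ} {A : Fin m → Fin m → Bool} {Gs : Fin m → Graph} where

  subst-edge-inside : ∀ i (u v : V (Gs i)) → E (Subst m A Gs) (i , u) (i , v) ≡ E (Gs i) u v
  subst-edge-inside i u v with i ≟ i
  ... | yes refl = refl
  ... | no i≢i = ⊥-elim (i≢i refl)

  subst-edge-across : ∀ (x y : V (Subst m A Gs)) → proj₁ x ≢ proj₁ y →
                      E (Subst m A Gs) x y ≡ A (proj₁ x) (proj₁ y)
  subst-edge-across (i , u) (j , v) i≢j with i ≟ j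
  ... | yes i≡j = ⊥-elim (i≢j i≡j)
  ... | no _ = refl

join-edge-across : ∀ {t Gs} (x y : V (Join t Gs)) → proj₁ x ≢ proj₁ y →
                   E (Join t Gs) x y ≡ true
-- Both Subst and the adjacency of Join test i ≟ j.
join-edge-across (i , u) (j , v) i≢j with i ≟ j
... | yes i≡j = ⊥-elim (i≢j i≡j)
... | no _ with i ≟ j
...   | yes i≡j = ⊥-elim (i≢j i≡j)
...   | no _ = refl

Near : ℕ → ℕ → Set
Near a b = a ≡ b ⊎ suc a ≡ b ⊎ suc b ≡ a

Consecutive : ℕ → ℕ → Set
Consecutive a b = suc a ≡ b ⊎ suc b ≡ a

near? : ∀ a b → Dec (Near a b)
near? a b = a ℕ.≟ b ⊎-dec suc a ℕ.≟ b ⊎-dec suc b ℕ.≟ a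

near-sym : ∀ {a b} → Near a b → Near b a
near-sym (inj₁ a≡b) = inj₁ (sym a≡b)
near-sym (inj₂ (inj₁ e)) = inj₂ (inj₂ e)
near-sym (inj₂ (inj₂ e)) = inj₂ (inj₁ e)

near-≤ : ∀ {a b} → Near a b → b ≤ suc a
near-≤ (inj₁ refl) = n≤1+n _
near-≤ (inj₂ (inj₁ refl)) = ≤-refl
near-≤ (inj₂ (inj₂ refl)) = m≤n⇒m≤1+n (n≤1+n _)

far : ∀ {a b} → suc (suc a) ≤ b → ¬ Near a b
far 2+a≤b near = 1+n≰n (≤-trans 2+a≤b (near-≤ near))

far-sym : ∀ {a b} → suc (suc a) ≤ b → ¬ Near b a
far-sym 2+a≤b = far 2+a≤b ∘ near-sym

near⇒consecutive : ∀ {a b} → Near a b → a ≢ b → Consecutive a b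
near⇒consecutive (inj₁ a≡b) a≢b = ⊥-elim (a≢b a≡b)
near⇒consecutive (inj₂ consecutive) _ = consecutive

consecutive-sym : ∀ {a b} → Consecutive a b → Consecutive b a
consecutive-sym (inj₁ e) = inj₂ e
consecutive-sym (inj₂ e) = inj₁ e

distinct-consecutive⇒far : ∀ {x y z} → Consecutive x y → Consecutive x z → y ≢ z →
                           ¬ Near y z
distinct-consecutive⇒far (inj₁ refl) (inj₁ refl) y≢z = ⊥-elim (y≢z refl)
distinct-consecutive⇒far (inj₁ refl) (inj₂ refl) _ = far-sym ≤-refl
distinct-consecutive⇒far (inj₂ refl) (inj₁ refl) _ = far ≤-refl
distinct-consecutive⇒far (inj₂ p) (inj₂ q) y≢z =
  ⊥-elim (y≢z (suc-injective (trans p (sym q))))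

three-distinct⇒far-pair : ∀ {x y z} → x ≢ y → y ≢ z → x ≢ z →
                          ¬ Near x y ⊎ ¬ Near x z ⊎ ¬ Near y z
three-distinct⇒far-pair {x} {y} {z} x≢y y≢z x≢z with near? x y | near? x z
... | no far-xy | _ = inj₁ far-xy
... | yes _ | no far-xz = inj₂ (inj₁ far-xz)
... | yes xy | yes xz =
  inj₂ (inj₂ (distinct-consecutive⇒far (near⇒consecutive xy x≢y)
                                       (near⇒consecutive xz x≢z) y≢z))

three-consecutive⇒two-equal : ∀ {f x y z} →
  Consecutive x f → Consecutive y f → Consecutive z f → x ≡ y ⊎ y ≡ z ⊎ x ≡ z
three-consecutive⇒two-equal (inj₁ p) (inj₁ q) _ = inj₁ (suc-injective (trans p (sym q)))
three-consecutive⇒two-equal (inj₂ p) (inj₂ q) _ = inj₁ (trans (sym p) q)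
three-consecutive⇒two-equal _ (inj₁ q) (inj₁ r) =
  inj₂ (inj₁ (suc-injective (trans q (sym r))))
three-consecutive⇒two-equal _ (inj₂ q) (inj₂ r) = inj₂ (inj₁ (trans (sym q) r))
three-consecutive⇒two-equal (inj₁ p) _ (inj₁ r) =
  inj₂ (inj₂ (suc-injective (trans p (sym r))))
three-consecutive⇒two-equal (inj₂ p) _ (inj₂ r) = inj₂ (inj₂ (trans (sym p) r))

common-consecutive-sum : ∀ {x f g} → Consecutive x f → Consecutive x g → f ≢ g →
                         f + g ≡ x + x
common-consecutive-sum (inj₁ refl) (inj₁ refl) f≢g = ⊥-elim (f≢g refl)
common-consecutive-sum (inj₁ refl) (inj₂ refl) _ = cong suc (sym (+-suc _ _))
common-consecutive-sum {f = f} (inj₂ refl) (inj₁ refl) _ = +-suc f (suc f)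
common-consecutive-sum (inj₂ p) (inj₂ q) f≢g =
  ⊥-elim (f≢g (suc-injective (trans p (sym q))))

double-injective : ∀ {m n} → m + m ≡ n + n → m ≡ n
double-injective {m} {n} eq with <-cmp m n
... | tri< m<n _ _ = contradiction eq (<⇒≢ (+-mono-< m<n m<n))
... | tri≈ _ m≡n _ = m≡n
... | tri> _ _ n<m = contradiction (sym eq) (<⇒≢ (+-mono-< n<m n<m))

common-consecutive-unique : ∀ {x y f g} → Consecutive x f → Consecutive x g →
  Consecutive y f → Consecutive y g → f ≢ g → x ≡ y
common-consecutive-unique xf xg yf yg f≢g =
  double-injective (trans (sym (common-consecutive-sum xf xg f≢g))
                          (common-consecutive-sum yf yg f≢g))

coPath : ℕ → ℕ → Bool
coPath a b = not (does (near? a b))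

coPath-near : ∀ {a b} → Near a b → coPath a b ≡ false
coPath-near {a} {b} near = cong not (dec-true (near? a b) near)

coPath-far : ∀ {a b} → ¬ Near a b → coPath a b ≡ true
coPath-far {a} {b} far-ab = cong not (dec-false (near? a b) far-ab)

coPath-sym : ∀ a b → coPath a b ≡ coPath b a
coPath-sym a b with near? a b
... | yes near = trans (coPath-near near) (sym (coPath-near (near-sym near)))
... | no far-ab = trans (coPath-far far-ab) (sym (coPath-far (far-ab ∘ near-sym)))

coPath-irrefl : ∀ a → coPath a a ≡ false
coPath-irrefl a = coPath-near {a} {a} (inj₁ refl)

near-far⇒coPath-≢ : ∀ {w a b} → Near w a → ¬ Near w b → coPath w a ≢ coPath w b
near-far⇒coPath-≢ near far-wb e =
  contradiction (trans (sym (coPath-near near)) (trans e (coPath-far far-wb))) λ ()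

module _ {r : ℕ} {l : Fin r → ℕ} (l-injective : Injective _≡_ _≡_ l) where

  private
    labels-≢ : ∀ {i j} → i ≢ j → l i ≢ l j
    labels-≢ i≢j = i≢j ∘ l-injective

  three-vertices-far-pair : 3 ≤ r → ∃₂ λ a b → a ≢ b × ¬ Near (l a) (l b)
  three-vertices-far-pair (s≤s (s≤s (s≤s _)))
    with three-distinct⇒far-pair {l (# 0)} {l (# 1)} {l (# 2)}
           (labels-≢ λ ()) (labels-≢ λ ()) (labels-≢ λ ())
  ... | inj₁ far-01 = _ , _ , (λ ()) , far-01
  ... | inj₂ (inj₁ far-02) = _ , _ , (λ ()) , far-02
  ... | inj₂ (inj₂ far-12) = _ , _ , (λ ()) , far-12

  bichromatic-far-pair : 4 ≤ r → {P : Pred (Fin r) 0ℓ} → Decidable P →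
                         ∀ {a b} → P a → ¬ P b → ∃₂ λ i j → P i × ¬ P j × ¬ Near (l i) (l j)
  bichromatic-far-pair (s≤s (s≤s (s≤s (s≤s _)))) {P} P? {a} {b} Pa ¬Pb
    with any? (λ i → any? λ j → P? i ×-dec ¬? (P? j) ×-dec ¬? (near? (l i) (l j)))
  ... | yes found = found
  ... | no none = ⊥-elim (four-vertices (P? (# 0)) (P? (# 1)) (P? (# 2)) (P? (# 3)))
    where
    -- Here every crossing pair is near.  As Near has maximum degree 2 and no 4-cycle, three
    -- vertices of one colour or two of each colour among the first four are impossible.

    crossing : ∀ {i j} → P i → ¬ P j → Consecutive (l i) (l j)
    crossing {i} {j} Pi ¬Pj =
      near⇒consecutive (decidable-stable (near? _ _) λ far-ij → none (i , j , Pi , ¬Pj , far-ij))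
                       (labels-≢ λ { refl → ¬Pj Pi })

    distinct-labels : ∀ {i j k} → i ≢ j → j ≢ k → i ≢ k →
                      ¬ (l i ≡ l j ⊎ l j ≡ l k ⊎ l i ≡ l k)
    distinct-labels i≢j j≢k i≢k = [ labels-≢ i≢j , [ labels-≢ j≢k , labels-≢ i≢k ] ]

    three-inside : ∀ {i j k} → i ≢ j → j ≢ k → i ≢ k → P i → P j → P k → ⊥
    three-inside i≢j j≢k i≢k Pi Pj Pk = distinct-labels i≢j j≢k i≢k
      (three-consecutive⇒two-equal (crossing Pi ¬Pb) (crossing Pj ¬Pb) (crossing Pk ¬Pb))

    three-outside : ∀ {i j k} → i ≢ j → j ≢ k → i ≢ k → ¬ P i → ¬ P j → ¬ P k → ⊥
    three-outside i≢j j≢k i≢k ¬Pi ¬Pj ¬Pk = distinct-labels i≢j j≢k i≢k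
      (three-consecutive⇒two-equal (consecutive-sym (crossing Pa ¬Pi))
        (consecutive-sym (crossing Pa ¬Pj)) (consecutive-sym (crossing Pa ¬Pk)))

    two-and-two : ∀ {i j i' j'} → i ≢ j → i' ≢ j' → P i → P j → ¬ P i' → ¬ P j' → ⊥
    two-and-two i≢j i'≢j' Pi Pj ¬Pi' ¬Pj' = labels-≢ i≢j
      (common-consecutive-unique (crossing Pi ¬Pi') (crossing Pi ¬Pj')
        (crossing Pj ¬Pi') (crossing Pj ¬Pj') (labels-≢ i'≢j'))

    four-vertices : Dec (P (# 0)) → Dec (P (# 1)) → Dec (P (# 2)) → Dec (P (# 3)) → ⊥
    four-vertices (yes p₀) (yes p₁) (yes p₂) _ = three-inside (λ ()) (λ ()) (λ ()) p₀ p₁ p₂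
    four-vertices (yes p₀) (yes p₁) (no _) (yes p₃) = three-inside (λ ()) (λ ()) (λ ()) p₀ p₁ p₃
    four-vertices (yes p₀) (no _) (yes p₂) (yes p₃) = three-inside (λ ()) (λ ()) (λ ()) p₀ p₂ p₃
    four-vertices (no _) (yes p₁) (yes p₂) (yes p₃) = three-inside (λ ()) (λ ()) (λ ()) p₁ p₂ p₃
    four-vertices (no q₀) (no q₁) (no q₂) _ = three-outside (λ ()) (λ ()) (λ ()) q₀ q₁ q₂
    four-vertices (no q₀) (no q₁) (yes _) (no q₃) = three-outside (λ ()) (λ ()) (λ ()) q₀ q₁ q₃
    four-vertices (no q₀) (yes _) (no q₂) (no q₃) = three-outside (λ ()) (λ ()) (λ ()) q₀ q₂ q₃
    four-vertices (yes _) (no q₁) (no q₂) (no q₃) = three-outside (λ ()) (λ ()) (λ ()) q₁ q₂ q₃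
    four-vertices (yes p₀) (yes p₁) (no q₂) (no q₃) = two-and-two (λ ()) (λ ()) p₀ p₁ q₂ q₃
    four-vertices (yes p₀) (no q₁) (yes p₂) (no q₃) = two-and-two (λ ()) (λ ()) p₀ p₂ q₁ q₃
    four-vertices (yes p₀) (no q₁) (no q₂) (yes p₃) = two-and-two (λ ()) (λ ()) p₀ p₃ q₁ q₂
    four-vertices (no q₀) (yes p₁) (yes p₂) (no q₃) = two-and-two (λ ()) (λ ()) p₁ p₂ q₀ q₃
    four-vertices (no q₀) (yes p₁) (no q₂) (yes p₃) = two-and-two (λ ()) (λ ()) p₁ p₃ q₀ q₂
    four-vertices (no q₀) (no q₁) (yes p₂) (yes p₃) = two-and-two (λ ()) (λ ()) p₂ p₃ q₀ q₁

-- Two consecutive members force their neighbours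
-- into M, and members x < y force two consecutive ones: otherwise x + 1 ∉ M splits x from y,
-- unless y = x + 2, where a fourth vertex is needed.
module CoPathPrime {n : ℕ} {M : ℕ → Set} (M? : Decidable M)
  (uniform : ∀ {w a b} → w < n → a < n → b < n → ¬ M w → M a → M b →
             coPath w a ≡ coPath w b)
  where

  private
    no-splitter : ∀ {w a b} → w < n → a < n → b < n → ¬ M w → M a → M b →
                  Near w a → ¬ Near w b → ⊥
    no-splitter w<n a<n b<n ¬Mw Ma Mb near far-wb =
      near-far⇒coPath-≢ near far-wb (uniform w<n a<n b<n ¬Mw Ma Mb)

    pair-up : ∀ {i} → M i → M (suc i) → suc (suc i) < n → M (suc (suc i))
    pair-up Mi Mi+1 i+2<n = decidable-stable (M? _) λ ¬Mi+2 →
      no-splitter i+2<n (<⇒≤ i+2<n) (<⇒≤ (<⇒≤ i+2<n)) ¬Mi+2 Mi+1 Mi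
                  (inj₂ (inj₂ refl)) (far-sym ≤-refl)

    pair-down : ∀ {i} → M (suc i) → M (suc (suc i)) → suc (suc i) < n → M i
    pair-down Mi+1 Mi+2 i+2<n = decidable-stable (M? _) λ ¬Mi →
      no-splitter (<⇒≤ (<⇒≤ i+2<n)) (<⇒≤ i+2<n) i+2<n ¬Mi Mi+1 Mi+2
                  (inj₂ (inj₁ refl)) (far ≤-refl)

  module _ {j} (j+1<n : suc j < n) (Mj : M j) (Mj+1 : M (suc j)) where

    private
      upward : ∀ {a} → j ≤′ a → suc a < n → M a × M (suc a)
      upward ≤′-refl _ = Mj , Mj+1
      upward (≤′-step j≤a) a+1<n with upward j≤a (<⇒≤ a+1<n)
      ... | Ma , Ma+1 = Ma+1 , pair-up Ma Ma+1 a+1<n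

      downward : ∀ {a} → a ≤‴ j → M a × M (suc a)
      downward ≤‴-refl = Mj , Mj+1
      downward (≤‴-step a+1≤j) with downward a+1≤j
      ... | Ma+1 , Ma+2 =
        pair-down Ma+1 Ma+2 (≤-trans (s≤s (s≤s (≤‴⇒≤ a+1≤j))) j+1<n) , Ma+1

      above : ∀ {a} → j ≤′ a → a < n → M a
      above ≤′-refl _ = Mj
      above (≤′-step j≤a) a<n = proj₂ (upward j≤a a<n)

    consecutive-members⇒all : ∀ {a} → a < n → M a
    consecutive-members⇒all {a} a<n with ≤-total j a
    ... | inj₁ j≤a = above (≤⇒≤′ j≤a) a<n
    ... | inj₂ a≤j = proj₁ (downward (≤⇒≤‴ a≤j))

  private
    gap-of-one : 4 ≤ n → ∀ {x} → suc (suc x) < n → M x → M (suc (suc x)) → ¬ M (suc x) → ⊥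
    gap-of-one n≥4 {zero} 2<n M0 M2 ¬M1 with M? 3
    ... | yes M3 = no-splitter (<⇒≤ 2<n) (<⇒≤ (<⇒≤ 2<n)) n≥4 ¬M1 M0 M3
                     (inj₂ (inj₂ refl)) (far ≤-refl)
    ... | no ¬M3 = no-splitter n≥4 2<n (<⇒≤ (<⇒≤ 2<n)) ¬M3 M2 M0
                     (inj₂ (inj₂ refl)) (far-sym (s≤s (s≤s z≤n)))
    gap-of-one _ {suc x} x+3<n Mx+1 Mx+3 ¬Mx+2 with M? x
    ... | yes Mx = no-splitter (<⇒≤ x+3<n) (<⇒≤ (<⇒≤ x+3<n)) (<⇒≤ (<⇒≤ (<⇒≤ x+3<n)))
                     ¬Mx+2 Mx+1 Mx (inj₂ (inj₂ refl)) (far-sym ≤-refl)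
    ... | no ¬Mx = no-splitter (<⇒≤ (<⇒≤ (<⇒≤ x+3<n))) (<⇒≤ (<⇒≤ x+3<n)) x+3<n
                     ¬Mx Mx+1 Mx+3 (inj₂ (inj₁ refl)) (far (n≤1+n _))

    consecutive-members : 4 ≤ n → ∀ {x y} → suc x ≤′ y → y < n → M x → M y →
                          ∃ λ j → suc j < n × M j × M (suc j)
    consecutive-members _ ≤′-refl y<n Mx My = _ , y<n , Mx , My
    consecutive-members n≥4 {x} (≤′-step x+1≤′y′) y<n Mx My with M? (suc x)
    ... | yes Mx+1 = x , ≤-trans (s≤s (≤′⇒≤ x+1≤′y′)) (<⇒≤ y<n) , Mx , Mx+1
    ... | no ¬Mx+1 = ⊥-elim (no-gap x+1≤′y′ y<n My)
      where
      no-gap : ∀ {y′} → suc x ≤′ y′ → suc y′ < n → M (suc y′) → ⊥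
      no-gap ≤′-refl x+2<n Mx+2 = gap-of-one n≥4 x+2<n Mx Mx+2 ¬Mx+1
      no-gap {suc y″} (≤′-step x+1≤′y″) y<n My =
        no-splitter x+1<n (<⇒≤ x+1<n) y<n ¬Mx+1 Mx My (inj₂ (inj₂ refl)) (far (s≤s (s≤s x+1≤y″)))
        where
        x+1≤y″ : suc x ≤ y″
        x+1≤y″ = ≤′⇒≤ x+1≤′y″
        x+1<n : suc x < n
        x+1<n = ≤-trans (s≤s (m≤n⇒m≤1+n (m≤n⇒m≤1+n x+1≤y″))) y<n

    ordered-members⇒all : 4 ≤ n → ∀ {x y} → x < y → y < n → M x → M y →
                          ∀ {a} → a < n → M a
    ordered-members⇒all n≥4 x<y y<n Mx My
      with consecutive-members n≥4 (≤⇒≤′ x<y) y<n Mx My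
    ... | j , j+1<n , Mj , Mj+1 = consecutive-members⇒all j+1<n Mj Mj+1

  prime : 4 ≤ n → ∀ {x y} → x < n → y < n → x ≢ y → M x → M y →
          ∀ {a} → a < n → M a
  prime n≥4 {x} {y} x<n y<n x≢y Mx My with <-cmp x y
  ... | tri< x<y _ _ = ordered-members⇒all n≥4 x<y y<n Mx My
  ... | tri≈ _ x≡y _ = ⊥-elim (x≢y x≡y)
  ... | tri> _ _ y<x = ordered-members⇒all n≥4 y<x x<n My Mx

record InducedCoPath {r : ℕ} (label : Fin r → ℕ) (G : Graph) : Set where
  field
    vertex : Fin r → V G
    vertex-injective : Injective _≡_ _≡_ vertex
    edge : ∀ {a b} → a ≢ b → E G (vertex a) (vertex b) ≡ coPath (label a) (label b)
open InducedCoPath public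

module _ {r : ℕ} {l : Fin r → ℕ} where

  reindex : ∀ {s G} (ρ : Fin s → Fin r) → Injective _≡_ _≡_ ρ →
            InducedCoPath l G → InducedCoPath (l ∘ ρ) G
  reindex ρ ρ-injective c = record
    { vertex = vertex c ∘ ρ
    ; vertex-injective = ρ-injective ∘ vertex-injective c
    ; edge = λ a≢b → edge c (a≢b ∘ ρ-injective)
    }

  transport : ∀ {G H} → G ≅ H → InducedCoPath l G → InducedCoPath l H
  transport (f , f-edge) c = record
    { vertex = Inverse.to f ∘ vertex c
    ; vertex-injective = vertex-injective c ∘ Injection.injective (↔⇒↣ f)
    ; edge = λ a≢b → trans (sym (f-edge _ _)) (edge c a≢b)
    }

  pullback : ∀ {G H} (φ : V G → V H) → (∀ u v → E H (φ u) (φ v) ≡ E G u v) →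
             (c : InducedCoPath l H) → (∀ a → ∃ λ u → vertex c a ≡ φ u) → InducedCoPath l G
  pullback {G} {H} φ φ-edge c preimage = record
    { vertex = vertex′
    ; vertex-injective = λ eq →
        vertex-injective c (trans (image _) (trans (cong φ eq) (sym (image _))))
    ; edge = edge′
    }
    where
    vertex′ : Fin r → V G
    vertex′ a = proj₁ (preimage a)

    image : ∀ a → vertex c a ≡ φ (vertex′ a)
    image a = proj₂ (preimage a)

    edge′ : ∀ {a b} → a ≢ b → E G (vertex′ a) (vertex′ b) ≡ coPath (l a) (l b)
    edge′ {a} {b} a≢b = begin
      E G (vertex′ a) (vertex′ b)          ≡⟨ sym (φ-edge _ _) ⟩
      E H (φ (vertex′ a)) (φ (vertex′ b))  ≡⟨ sym (cong₂ (E H) (image a) (image b)) ⟩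
      E H (vertex c a) (vertex c b)        ≡⟨ edge c a≢b ⟩
      coPath (l a) (l b)                   ∎
      where open ≡-Reasoning

  part : ∀ {m A Gs} → InducedCoPath l (Subst m A Gs) → Fin r → Fin m
  part c a = proj₁ (vertex c a)

  restrict-to-part : ∀ {m A Gs} (c : InducedCoPath l (Subst m A Gs)) {i} →
                     (∀ a → part c a ≡ i) → InducedCoPath l (Gs i)
  restrict-to-part {m} {A} {Gs} c {i} in-i =
    pullback (i ,_) (subst-edge-inside i) c (λ a → as-member (vertex c a) (in-i a))
    where
    as-member : (x : V (Subst m A Gs)) → proj₁ x ≡ i → ∃ λ u → x ≡ (i , u)
    as-member (_ , u) refl = u , refl

  drop-new-vertex : ∀ {G N} (c : InducedCoPath l (Inc G N)) →
                    (∀ a → vertex c a ≢ inj₂ tt) → InducedCoPath l G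
  drop-new-vertex {G} c old =
    pullback inj₁ (λ _ _ → refl) c (λ a → as-old (vertex c a) (old a))
    where
    as-old : (x : V G ⊎ ⊤) → x ≢ inj₂ tt → ∃ λ u → x ≡ inj₁ u
    as-old (inj₁ u) _ = u , refl
    as-old (inj₂ tt) x-old = ⊥-elim (x-old refl)

remove-new-vertex : ∀ {r G N} {l : Fin (suc r) → ℕ} (c : InducedCoPath l (Inc G N)) {x} →
                    vertex c x ≡ inj₂ tt → InducedCoPath (l ∘ punchIn x) G
remove-new-vertex c {x} x-new =
  drop-new-vertex (reindex (punchIn x) (punchIn-injective x _ _) c) λ j j-new →
    punchInᵢ≢i x j (vertex-injective c (trans j-new (sym x-new)))

new-vertex? : ∀ {X : Set} (x : X ⊎ ⊤) → Dec (x ≡ inj₂ tt)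
new-vertex? (inj₁ _) = no λ ()
new-vertex? (inj₂ tt) = yes refl

depth-0-empty : ∀ {G} → TDExpr 0 G → ¬ V G
depth-0-empty ∘e ()
depth-0-empty (unionE _ _ _ sub) (i , u) = depth-0-empty (sub i) u

edge⇒depth-≥2 : ∀ {k G} → TDExpr k G → ∀ {u v} → E G u v ≡ true → 2 ≤ k
edge⇒depth-≥2 ∘e {()}
edge⇒depth-≥2 (unionE _ _ _ sub) {i , u} {j , v} uv with i ≟ j
... | yes refl = edge⇒depth-≥2 (sub i) uv
... | no _ = contradiction uv λ ()
edge⇒depth-≥2 {suc (suc _)} (incE _ _ _) _ = s≤s (s≤s z≤n)
edge⇒depth-≥2 {suc zero} (incE _ _ sub) {inj₁ u} _ = ⊥-elim (depth-0-empty sub u)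
edge⇒depth-≥2 {suc zero} (incE _ _ sub) {inj₂ _} {inj₁ v} _ = ⊥-elim (depth-0-empty sub v)
edge⇒depth-≥2 {suc zero} (incE _ _ _) {inj₂ _} {inj₂ _} ()

module _ {r : ℕ} {l : Fin r → ℕ} (l-injective : Injective _≡_ _≡_ l) where

  three-vertices⇒depth-≥2 : ∀ {k G} → TDExpr k G → InducedCoPath l G → 3 ≤ r → 2 ≤ k
  three-vertices⇒depth-≥2 expr c r≥3 with three-vertices-far-pair l-injective r≥3
  ... | a , b , a≢b , far-ab = edge⇒depth-≥2 expr (trans (edge c a≢b) (coPath-far far-ab))

  union-one-part : ∀ {t Gs} → 4 ≤ r → (c : InducedCoPath l (Union t Gs)) →
                   ∃ λ i → ∀ a → part c a ≡ i
  union-one-part {t} {Gs} r≥4@(s≤s _) c with all? (λ a → part c a ≟ part c zero)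
  ... | yes same = part c zero , same
  ... | no ¬same with ¬∀⟶∃¬ _ _ (λ a → part c a ≟ part c zero) ¬same
  ...   | j , j-elsewhere
          with bichromatic-far-pair l-injective r≥4 (λ a → part c a ≟ part c zero) refl j-elsewhere
  ...     | a , b , a-home , b-away , far-ab =
    contradiction bichromatic-edge λ ()
    where
    open ≡-Reasoning
    parts-≢ : part c a ≢ part c b
    parts-≢ eq = b-away (trans (sym eq) a-home)
    a≢b : a ≢ b
    a≢b refl = parts-≢ refl
    bichromatic-edge : true ≡ false
    bichromatic-edge = begin
      true                                       ≡⟨ sym (coPath-far far-ab) ⟩
      coPath (l a) (l b)                         ≡⟨ sym (edge c a≢b) ⟩
      E (Union t Gs) (vertex c a) (vertex c b)   ≡⟨ subst-edge-across _ _ parts-≢ ⟩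
      false                                      ∎

depth-bound : ∀ {k G r} {l : Fin r → ℕ} → TDExpr k G → Injective _≡_ _≡_ l →
              InducedCoPath l G → 4 ≤ r → r ≤ suc k
depth-bound ∘e _ c (s≤s _) with vertex c zero
... | ()
depth-bound (unionE _ _ _ sub) l-injective c r≥4 with union-one-part l-injective r≥4 c
... | i , in-i = depth-bound (sub i) l-injective (restrict-to-part c in-i) r≥4
depth-bound (incE _ _ sub) l-injective c r≥4 with any? (λ a → new-vertex? (vertex c a))
... | no untouched =
  m≤n⇒m≤1+n (depth-bound sub l-injective (drop-new-vertex c λ a a-new → untouched (a , a-new)) r≥4)
depth-bound (incE _ _ sub) l-injective c (s≤s r-1≥3) | yes (x , x-new)
  with m≤n⇒m<n∨m≡n r-1≥3
... | inj₁ r-1≥4 =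
  s≤s (depth-bound sub (punchIn-injective x _ _ ∘ l-injective) (remove-new-vertex c x-new) r-1≥4)
... | inj₂ refl = s≤s (s≤s (three-vertices⇒depth-≥2 (punchIn-injective x _ _ ∘ l-injective) sub
                                                   (remove-new-vertex c x-new) ≤-refl))

-- The primality argument runs on ℕ; clamp reads a part map there, and its junk value zero is
-- only taken outside the range that the argument inspects.
clamp : ∀ {n} → ℕ → Fin (suc n)
clamp {n} k with k <? suc n
... | yes k<n = fromℕ< k<n
... | no _ = zero

toℕ-clamp : ∀ {n k} → k < suc n → toℕ (clamp {n} k) ≡ k
toℕ-clamp {n} {k} k<n with k <? suc n
... | yes k<n′ = toℕ-fromℕ< k<n′
... | no k≮n = contradiction k<n k≮n

clamp-toℕ : ∀ {n} (a : Fin (suc n)) → clamp (toℕ a) ≡ a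
clamp-toℕ a = toℕ-injective (toℕ-clamp (toℕ<n a))

module _ {n m : ℕ} {A : Fin m → Fin m → Bool} {Gs : Fin m → Graph}
         (c : InducedCoPath {n} toℕ (Subst m A Gs)) where

  part-uniform : ∀ {w a b} → part c a ≡ part c b → part c w ≢ part c a →
                 coPath (toℕ w) (toℕ a) ≡ coPath (toℕ w) (toℕ b)
  part-uniform {w} {a} {b} same-part w-outside = begin
    coPath (toℕ w) (toℕ a)                          ≡⟨ sym (edge c w≢a) ⟩
    E (Subst m A Gs) (vertex c w) (vertex c a)      ≡⟨ subst-edge-across _ _ w-outside ⟩
    A (part c w) (part c a)                         ≡⟨ cong (A (part c w)) same-part ⟩
    A (part c w) (part c b)                         ≡⟨ sym (subst-edge-across _ _ w-outside′) ⟩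
    E (Subst m A Gs) (vertex c w) (vertex c b)      ≡⟨ edge c w≢b ⟩
    coPath (toℕ w) (toℕ b)                          ∎
    where
    open ≡-Reasoning
    w-outside′ : part c w ≢ part c b
    w-outside′ eq = w-outside (trans eq (sym same-part))
    w≢a : w ≢ a
    w≢a refl = w-outside refl
    w≢b : w ≢ b
    w≢b refl = w-outside′ refl

  one-part-or-injective : 4 ≤ n → (∃ λ i → ∀ a → part c a ≡ i) ⊎ Injective _≡_ _≡_ (part c)
  one-part-or-injective n≥4@(s≤s _) with all? (λ a → part c a ≟ part c zero)
  ... | yes same = inj₁ (part c zero , same)
  ... | no ¬same = inj₂ λ {x} {y} same-part → decidable-stable (x ≟ y) λ x≢y →
    ¬same λ a → trans (all-in-part-of x≢y same-part a) (sym (all-in-part-of x≢y same-part zero))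
    where
    all-in-part-of : ∀ {x y} → x ≢ y → part c x ≡ part c y → ∀ a → part c a ≡ part c x
    all-in-part-of {x} {y} x≢y same-part a =
      trans (cong (part c) (sym (clamp-toℕ a)))
            (prime n≥4 (toℕ<n x) (toℕ<n y) (x≢y ∘ toℕ-injective) Mx My (toℕ<n a))
      where
      M : ℕ → Set
      M k = part c (clamp k) ≡ part c x

      Mx : M (toℕ x)
      Mx = cong (part c) (clamp-toℕ x)

      My : M (toℕ y)
      My = trans (cong (part c) (clamp-toℕ y)) (sym same-part)

      M-uniform : ∀ {w a b} → w < n → a < n → b < n → ¬ M w → M a → M b → coPath w a ≡ coPath w b
      M-uniform {w} {a} {b} w<n a<n b<n ¬Mw Ma Mb = begin
        coPath w a                              ≡⟨ sym (cong₂ coPath (toℕ-clamp w<n) (toℕ-clamp a<n)) ⟩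
        coPath (toℕ (clamp w)) (toℕ (clamp a))  ≡⟨ part-uniform (trans Ma (sym Mb)) w-outside ⟩
        coPath (toℕ (clamp w)) (toℕ (clamp b))  ≡⟨ cong₂ coPath (toℕ-clamp w<n) (toℕ-clamp b<n) ⟩
        coPath w b                              ∎
        where
        open ≡-Reasoning
        w-outside : part c (clamp w) ≢ part c (clamp a)
        w-outside e = ¬Mw (trans e Ma)

      open CoPathPrime (λ k → part c (clamp k) ≟ part c x) M-uniform

  to-quotient : Injective _≡_ _≡_ (part c) → InducedCoPath {n} toℕ (FinGraph m A)
  to-quotient part-injective = record
    { vertex = part c
    ; vertex-injective = part-injective
    ; edge = λ a≢b → trans (sym (subst-edge-across _ _ (a≢b ∘ part-injective))) (edge c a≢b)
    }

quotient-embedding : ∀ {n P G} → 4 ≤ n → SubstExpr P G → InducedCoPath {n} toℕ G →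
                     ∃₂ λ m A → P m A × InducedCoPath {n} toℕ (FinGraph m A)
quotient-embedding (s≤s (s≤s _)) •e c with vertex-injective c {# 0} {# 1} refl
... | ()
quotient-embedding n≥4 (unionE _ _ _ sub) c with union-one-part toℕ-injective n≥4 c
... | i , in-i = quotient-embedding n≥4 (sub i) (restrict-to-part c in-i)
quotient-embedding n≥4@(s≤s (s≤s (s≤s _))) (joinE t _ Gs sub) c with one-part-or-injective c n≥4
... | inj₁ (i , in-i) = quotient-embedding n≥4 (sub i) (restrict-to-part c in-i)
... | inj₂ part-injective = contradiction (begin
      false                                            ≡⟨ sym (edge c 0≢1) ⟩
      E (Join t Gs) (vertex c (# 0)) (vertex c (# 1))  ≡⟨ join-edge-across _ _ parts-≢ ⟩
      true                                             ∎) λ ()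
  where
  open ≡-Reasoning
  0≢1 : # 0 ≢ # 1
  0≢1 ()
  parts-≢ : part c (# 0) ≢ part c (# 1)
  parts-≢ = 0≢1 ∘ part-injective
quotient-embedding n≥4 (substE m A _ Pm _ sub) c with one-part-or-injective c n≥4
... | inj₁ (i , in-i) = quotient-embedding n≥4 (sub i) (restrict-to-part c in-i)
... | inj₂ part-injective = m , A , Pm , to-quotient c part-injective

coPathAdj : (n : ℕ) → Fin n → Fin n → Bool
coPathAdj n a b = coPath (toℕ a) (toℕ b)

CoPathGraph : ℕ → Graph
CoPathGraph n = FinGraph n (coPathAdj n)

coPath-simple : ∀ n → SimpleAdj n (coPathAdj n)
coPath-simple n = (λ a b → coPath-sym (toℕ a) (toℕ b)) , (λ a → coPath-irrefl (toℕ a))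

FinGraph≅Subst-points : ∀ {m A} → (∀ i → A i i ≡ false) → FinGraph m A ≅ Subst m A (λ _ → oneGraph)
FinGraph≅Subst-points {m} {A} irrefl = mk↔ₛ′ (_, tt) proj₁ (λ _ → refl) (λ _ → refl) , same-edges
  where
  same-edges : ∀ u v → A u v ≡ E (Subst m A (λ _ → oneGraph)) (u , tt) (v , tt)
  same-edges u v with u ≟ v
  ... | yes refl = irrefl u
  ... | no _ = refl

coPath-∈-MW : ∀ n → MW n (CoPathGraph n)
coPath-∈-MW n = Subst n (coPathAdj n) (λ _ → oneGraph) ,
  substE n (coPathAdj n) (coPath-simple n) (lift ≤-refl) (λ _ → oneGraph) (λ _ → •e) ,
  FinGraph≅Subst-points (proj₂ (coPath-simple n))

coPath-identity : ∀ {n} → InducedCoPath toℕ (CoPathGraph n)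
coPath-identity = record { vertex = λ a → a ; vertex-injective = λ eq → eq ; edge = λ _ → refl }

coPath-∈-MTD⇒≤ : ∀ {n ℓ} → 4 ≤ n → MTD ℓ (CoPathGraph n) → n ≤ suc ℓ
coPath-∈-MTD⇒≤ n≥4 (_ , expr , X≅X′) with quotient-embedding n≥4 expr (transport X≅X′ coPath-identity)
... | _ , _ , (_ , td-expr , H≅H′) , c = depth-bound td-expr toℕ-injective (transport H≅H′ c) n≥4

1+ℓ<2*ℓ : ∀ {ℓ} → 2 ≤ ℓ → suc ℓ < 2 * ℓ
1+ℓ<2*ℓ {ℓ} 2≤ℓ = begin-strict
  suc ℓ   ≡⟨ +-comm 1 ℓ ⟩
  ℓ + 1   <⟨ +-monoʳ-< ℓ 2≤ℓ ⟩
  ℓ + ℓ   ≡⟨ cong (ℓ +_) (sym (+-identityʳ ℓ)) ⟩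
  2 * ℓ   ∎
  where open ≤-Reasoning

lemma30 : (ℓ : ℕ) → 2 ≤ ℓ →
    Σ Graph λ G → Finite G × Simple G × ¬ MTD ℓ G × MW (2 * ℓ) G
lemma30 ℓ 2≤ℓ =
  CoPathGraph (2 * ℓ) , (2 * ℓ , ↔-id _) , coPath-simple (2 * ℓ) ,
  (<⇒≱ (1+ℓ<2*ℓ 2≤ℓ) ∘ coPath-∈-MTD⇒≤ (*-monoʳ-≤ 2 2≤ℓ)) , coPath-∈-MW (2 * ℓ)
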